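{- Let $(P,\le)$ be a finite partially ordered set and let $I$ be an irreducible upper set of $P$. Then $\chi_I$ is a prime element of the monoid $\mathrm{M}(P)$ if and only if both of the following hold: 1. $\chi_I\not\le_{\mathrm{M}(P)}\chi_{G\cup H}$ and $\chi_I\not\le_{\mathrm{M}(P)}\chi_{G\cap H}$ for all irreducible upper sets $G,H$ with $G\ne I$ and $H\ne I$; 2. for every irreducible upper set $J\ne I$, $\{I,J\}$ is a near-chain.
   Context: $\mathrm{M}(P)$ is the monoid under pointwise addition of monotone functions $P\to\mathbb{N}$. An upper set is an upward-closed subset; an irreducible upper set is a nonempty upper set that is not the union of two disjoint nonempty upper sets; $\chi_U$ is the indicator function of $U$. $f\le_{\mathrm{M}(P)}g$ means $g=f+h$ for some $h\in\mathrm{M}(P)$. An element $a$ is prime if $a\le_{\mathrm{M}(P)}b+c$ implies $a\le_{\mathrm{M}(P)}b$ or $a\le_{\mathrm{M}(P)}c$. $\{I,J\}$ is a near-chain if $I\subseteq J$, $J\subseteq I$, or $I\cap J=\emptyset$. -}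

module Defs where

open import Data.Nat using (ℕ; _+_; _≤_)
open import Data.Bool using (true; false)
open import Data.Fin using (Fin)
open import Data.Fin.Subset using (Subset; _∈_; _∪_; _∩_; _⊆_; Nonempty; Empty)
open import Data.Vec using (lookup)
open import Data.Product using (Σ; _×_; ∃)
open import Data.Sum using (_⊎_)
open import Relation.Nullary using (¬_)
open import Relation.Binary.PropositionalEquality using (_≡_; _≢_)

-- A finite poset is modelled as Fin n with an order relation _≼_
-- (assumed a decidable partial order w.r.t. _≡_ in the theorem).

module _ {n : ℕ} (_≼_ : Fin n → Fin n → Set) where

  Monotone : (Fin n → ℕ) → Set
  Monotone f = ∀ x y → x ≼ y → f x ≤ f y

  _≤M_ : (Fin n → ℕ) → (Fin n → ℕ) → Set
  f ≤M g = Σ (Fin n → ℕ) λ h → Monotone h × (∀ x → g x ≡ f x + h x)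

  IsPrime : (Fin n → ℕ) → Set
  IsPrime a = ∀ b c → Monotone b → Monotone c →
              a ≤M (λ x → b x + c x) → (a ≤M b) ⊎ (a ≤M c)

  UpperSet : Subset n → Set
  UpperSet U = ∀ x y → x ≼ y → x ∈ U → y ∈ U

  Irreducible : Subset n → Set
  Irreducible U = UpperSet U × Nonempty U ×
    ¬ (Σ (Subset n) λ A → Σ (Subset n) λ B →
         UpperSet A × UpperSet B × Nonempty A × Nonempty B ×
         Empty (A ∩ B) × (A ∪ B ≡ U))

χ : ∀ {n} → Subset n → Fin n → ℕ
χ U x with lookup U x
... | true = 1
... | false = 0

NearChain : ∀ {n} → Subset n → Subset n → Set
NearChain I J = I ⊆ J ⊎ J ⊆ I ⊎ Empty (I ∩ J)

module Submission where

-- If χ_I ≤ χ_G with G irreducible, then χ_G − χ_I is the indicator of an upper set G ∖ I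
-- complementary to I inside G, so G = I.  Primality of χ_I applied to χ_G + χ_H and to
-- χ_I + χ_J = χ_{I∪J} + χ_{I∩J} therefore gives both conditions.  Conversely, condition 1 says
-- that I is not the union of two irreducible upper sets other than I; growing a connected union
-- of principal upper sets inside I then shows I = ↑m.  Condition 2 applied to ↑x makes m a
-- gateway: whatever lies outside ↑m but below some element of ↑m lies below m.  Then
-- χ_{↑m} ≤ f exactly when f jumps at m (f m ≥ 1 and f x < f m for x < m).  If b + c jumps at m
-- but neither b nor c does, witnesses x, x′ < m with b m ≤ b x and c m ≤ c x′ give
-- χ_{↑m} ≤ χ_{↑x ∩ ↑x′}, contradicting condition 1.

open import Defs
open import Data.Nat using (ℕ; zero; suc; _+_; _∸_; _≤_; _<_; z≤n; s≤s; _≤?_; _<?_)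
open import Data.Nat.Properties
  using (≤-refl; ≤-trans; <-≤-trans; +-comm; +-assoc; +-identityʳ; +-monoˡ-≤; +-monoʳ-≤; +-mono-≤;
         ∸-monoˡ-≤; m+[n∸m]≡n; m≤m+n; <⇒≱; ≮⇒≥; ≰⇒>; n<1⇒n≡0; +-suc; module ≤-Reasoning)
open import Data.Bool using (true; false)
open import Data.Fin using (Fin)
open import Data.Fin.Properties using (any?; all?)
open import Data.Fin.Subset using (Subset; _∈_; _∉_; _⊆_; _⊂_; _∪_; _∩_; ∁; Nonempty; Empty; ∣_∣)
open import Data.Fin.Subset.Properties
  using (_∈?_; nonempty?; ⊆-antisym; p⊆p∪q; q⊆p∪q; p∩q⊆p; p∩q⊆q; x∈p∩q⁺; x∈p∪q⁻;
         x∉p⇒x∈∁p; x∈∁p⇒x∉p; ∪-comm; ∩-comm; ∩-distribˡ-∪; p⊂q⇒∣p∣<∣q∣)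
open import Data.Vec using (lookup; tabulate)
open import Data.Vec.Properties using (lookup∘tabulate; lookup-zipWith; []=⇒lookup; lookup⇒[]=; ≡-dec)
open import Data.Product using (Σ; ∃; ∃₂; _×_; _,_; proj₁; proj₂)
open import Data.Sum using (_⊎_; inj₁; inj₂)
open import Function.Base using (_∘_)
open import Function.Bundles using (_⇔_; mk⇔)
open import Relation.Nullary using (¬_; Dec; yes; no; does; contradiction)
open import Relation.Nullary.Decidable using (_×-dec_; _→-dec_; ¬?; dec-true; dec-false; decidable-stable)
open import Relation.Binary.Structures using (IsDecPartialOrder)
open import Relation.Binary.PropositionalEquality
  using (_≡_; _≢_; refl; sym; trans; cong; cong₂; subst; subst₂; module ≡-Reasoning)

χ-∈ : ∀ {n} {U : Subset n} {x} → x ∈ U → χ U x ≡ 1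
χ-∈ x∈U rewrite []=⇒lookup x∈U = refl

χ-∉ : ∀ {n} {U : Subset n} {x} → x ∉ U → χ U x ≡ 0
χ-∉ {U = U} {x} x∉U with lookup U x in eq
... | true  = contradiction (lookup⇒[]= x U eq) x∉U
... | false = refl

χ-∪+χ-∩ : ∀ {n} (A B : Subset n) x → χ (A ∪ B) x + χ (A ∩ B) x ≡ χ A x + χ B x
χ-∪+χ-∩ A B x rewrite lookup-zipWith Data.Bool._∨_ x A B | lookup-zipWith Data.Bool._∧_ x A B
  with lookup A x | lookup B x
... | true  | true  = refl
... | true  | false = refl
... | false | true  = refl
... | false | false = refl

∁-disjoint : ∀ {n} (p q : Subset n) → Empty (p ∩ (q ∩ ∁ p))
∁-disjoint p q (x , x∈) = x∈∁p⇒x∉p (p∩q⊆q q (∁ p) (p∩q⊆q p _ x∈)) (p∩q⊆p p _ x∈)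

⊆-∪∁ : ∀ {n} (p q : Subset n) → q ⊆ p ∪ (q ∩ ∁ p)
⊆-∪∁ p q {x} x∈q with x ∈? p
... | yes x∈p = p⊆p∪q (q ∩ ∁ p) x∈p
... | no  x∉p = q⊆p∪q p (q ∩ ∁ p) (x∈p∩q⁺ (x∈q , x∉p⇒x∈∁p x∉p))

module _ {n : ℕ} (_≼_ : Fin n → Fin n → Set) where

  private
    Upper : Subset n → Set
    Upper = UpperSet _≼_

    Irr : Subset n → Set
    Irr = Irreducible _≼_

    Mono : (Fin n → ℕ) → Set
    Mono = Monotone _≼_

    infix 4 _≤ₘ_
    _≤ₘ_ : (Fin n → ℕ) → (Fin n → ℕ) → Set
    _≤ₘ_ = _≤M_ _≼_

    Connected : Subset n → Set
    Connected U = ¬ (Σ (Subset n) λ A → Σ (Subset n) λ B →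
      Upper A × Upper B × Nonempty A × Nonempty B × Empty (A ∩ B) × (A ∪ B ≡ U))

  Upper-∪ : ∀ {A B} → Upper A → Upper B → Upper (A ∪ B)
  Upper-∪ {A} {B} upA upB x y x≼y x∈A∪B with x∈p∪q⁻ A B x∈A∪B
  ... | inj₁ x∈A = p⊆p∪q B (upA x y x≼y x∈A)
  ... | inj₂ x∈B = q⊆p∪q A B (upB x y x≼y x∈B)

  Upper-∩ : ∀ {A B} → Upper A → Upper B → Upper (A ∩ B)
  Upper-∩ {A} {B} upA upB x y x≼y x∈A∩B =
    x∈p∩q⁺ (upA x y x≼y (p∩q⊆p A B x∈A∩B) , upB x y x≼y (p∩q⊆q A B x∈A∩B))

  χ-monotone : ∀ {U} → Upper U → Mono (χ U)
  χ-monotone {U} upU x y x≼y with x ∈? U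
  ... | yes x∈U rewrite χ-∈ x∈U | χ-∈ (upU x y x≼y x∈U) = ≤-refl
  ... | no  x∉U rewrite χ-∉ x∉U = z≤n

  ≤ₘ-refl : ∀ {f} → f ≤ₘ f
  ≤ₘ-refl {f} = (λ _ → 0) , (λ _ _ _ → z≤n) , λ x → sym (+-identityʳ (f x))

  ≤ₘ-+ʳ : ∀ {f g k} → f ≤ₘ g → Mono k → f ≤ₘ (λ x → g x + k x)
  ≤ₘ-+ʳ {f} {g} {k} (h , h-mono , g≡f+h) k-mono =
    (λ x → h x + k x) ,
    (λ x y x≼y → +-mono-≤ (h-mono x y x≼y) (k-mono x y x≼y)) ,
    λ x → trans (cong (_+ k x) (g≡f+h x)) (+-assoc (f x) (h x) (k x))

  ≤ₘ-resp-≗ : ∀ {f g g′} → (∀ x → g x ≡ g′ x) → f ≤ₘ g → f ≤ₘ g′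
  ≤ₘ-resp-≗ g≗g′ (h , h-mono , g≡f+h) = h , h-mono , λ x → trans (sym (g≗g′ x)) (g≡f+h x)

  ≤ₘ⇒≤ : ∀ {f g} → f ≤ₘ g → ∀ x → f x ≤ g x
  ≤ₘ⇒≤ {f} (h , _ , g≡f+h) x = subst (f x ≤_) (sym (g≡f+h x)) (m≤m+n (f x) (h x))

  -- The gap g − f is monotone; stated without truncated subtraction.
  ≤ₘ-gap-monotone : ∀ {f g} → f ≤ₘ g → ∀ {x y} → x ≼ y → g x + f y ≤ f x + g y
  ≤ₘ-gap-monotone {f} {g} (h , h-mono , g≡f+h) {x} {y} x≼y = begin
    g x + f y         ≡⟨ cong (_+ f y) (g≡f+h x) ⟩
    f x + h x + f y   ≤⟨ +-monoˡ-≤ (f y) (+-monoʳ-≤ (f x) (h-mono x y x≼y)) ⟩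
    f x + h y + f y   ≡⟨ +-assoc (f x) (h y) (f y) ⟩
    f x + (h y + f y) ≡⟨ cong (f x +_) (trans (+-comm (h y) (f y)) (sym (g≡f+h y))) ⟩
    f x + g y         ∎
    where open ≤-Reasoning

  χ-≤ₘ⇒⊆ : ∀ {A B} → χ A ≤ₘ χ B → A ⊆ B
  χ-≤ₘ⇒⊆ {A} {B} χA≤χB {x} x∈A with x ∈? B
  ... | yes x∈B = x∈B
  ... | no  x∉B = contradiction (subst₂ _≤_ (χ-∈ x∈A) (χ-∉ x∉B) (≤ₘ⇒≤ χA≤χB x)) λ ()

  χ-≤ₘ⇒Upper-∩∁ : ∀ {A B} → Upper B → χ A ≤ₘ χ B → Upper (B ∩ ∁ A)
  χ-≤ₘ⇒Upper-∩∁ {A} {B} upB χA≤χB y z y≼z y∈B∖A =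
    x∈p∩q⁺ (upB y z y≼z y∈B , x∉p⇒x∈∁p z∉A)
    where
    y∈B = p∩q⊆p B (∁ A) y∈B∖A
    y∉A = x∈∁p⇒x∉p (p∩q⊆q B (∁ A) y∈B∖A)
    z∉A : z ∉ A
    z∉A z∈A = contradiction (≤ₘ-gap-monotone χA≤χB y≼z)
                            (subst₂ (λ u v → ¬ (u ≤ v)) eq₁ eq₂ λ { (s≤s ()) })
      where
      eq₁ : 2 ≡ χ B y + χ A z
      eq₁ = sym (cong₂ _+_ (χ-∈ y∈B) (χ-∈ z∈A))
      eq₂ : 1 ≡ χ A y + χ B z
      eq₂ = sym (cong₂ _+_ (χ-∉ y∉A) (χ-∈ (χ-≤ₘ⇒⊆ {A} {B} χA≤χB z∈A)))

  irreducible-⊆-side : ∀ {K A B} → Irr K → Upper A → Upper B → Empty (A ∩ B) →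
                       K ⊆ A ∪ B → Nonempty (K ∩ A) → K ⊆ A
  irreducible-⊆-side {K} {A} {B} (upK , _ , connected) upA upB A∩B=∅ K⊆A∪B K∩A≠∅ {x} x∈K
    with x∈p∪q⁻ A B (K⊆A∪B x∈K)
  ... | inj₁ x∈A = x∈A
  ... | inj₂ x∈B = contradiction
          (K ∩ A , K ∩ B , Upper-∩ upK upA , Upper-∩ upK upB , K∩A≠∅ , (x , x∈p∩q⁺ (x∈K , x∈B)) ,
           disjoint , cover)
          connected
    where
    disjoint : Empty ((K ∩ A) ∩ (K ∩ B))
    disjoint (y , y∈) =
      A∩B=∅ (y , x∈p∩q⁺ (p∩q⊆q K A (p∩q⊆p _ _ y∈) , p∩q⊆q K B (p∩q⊆q (K ∩ A) _ y∈)))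
    cover : K ∩ A ∪ K ∩ B ≡ K
    cover = begin
      K ∩ A ∪ K ∩ B ≡⟨ ∩-distribˡ-∪ K A B ⟨
      K ∩ (A ∪ B)   ≡⟨ ⊆-antisym (p∩q⊆p K (A ∪ B)) (λ y∈K → x∈p∩q⁺ (y∈K , K⊆A∪B y∈K)) ⟩
      K             ∎
      where open ≡-Reasoning

  irreducible-⊆ : ∀ {G A} → Irr G → Upper A → Upper (G ∩ ∁ A) → Nonempty (G ∩ A) → G ⊆ A
  irreducible-⊆ {G} {A} irG upA upG∖A =
    irreducible-⊆-side irG upA upG∖A (∁-disjoint A G) (⊆-∪∁ A G)

  irreducible-∪ : ∀ {K L} → Irr K → Irr L → Nonempty (K ∩ L) → Irr (K ∪ L)
  irreducible-∪ {K} {L} irK@(upK , _) irL@(upL , _) (z , z∈K∩L) =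
    Upper-∪ upK upL , (z , p⊆p∪q L z∈K) , connected
    where
    z∈K = p∩q⊆p K L z∈K∩L
    z∈L = p∩q⊆q K L z∈K∩L
    absorbed : ∀ {A B} → Upper A → Upper B → Empty (A ∩ B) → A ∪ B ≡ K ∪ L → z ∈ A → B ⊆ A
    absorbed {A} {B} upA upB A∩B=∅ A∪B≡K∪L z∈A b∈B
      with x∈p∪q⁻ K L (subst (_ ∈_) A∪B≡K∪L (q⊆p∪q A B b∈B))
    ... | inj₁ b∈K = irreducible-⊆-side irK upA upB A∩B=∅
                       (subst (K ⊆_) (sym A∪B≡K∪L) (p⊆p∪q L)) (z , x∈p∩q⁺ (z∈K , z∈A)) b∈K
    ... | inj₂ b∈L = irreducible-⊆-side irL upA upB A∩B=∅
                       (subst (L ⊆_) (sym A∪B≡K∪L) (q⊆p∪q K L)) (z , x∈p∩q⁺ (z∈L , z∈A)) b∈L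
    connected : Connected (K ∪ L)
    connected (A , B , upA , upB , (a , a∈A) , (b , b∈B) , A∩B=∅ , A∪B≡K∪L)
      with x∈p∪q⁻ A B (subst (z ∈_) (sym A∪B≡K∪L) (p⊆p∪q L z∈K))
    ... | inj₁ z∈A = A∩B=∅ (b , x∈p∩q⁺ (absorbed upA upB A∩B=∅ A∪B≡K∪L z∈A b∈B , b∈B))
    ... | inj₂ z∈B = A∩B=∅ (a , x∈p∩q⁺ (a∈A , absorbed upB upA B∩A=∅ B∪A≡K∪L z∈B a∈A))
      where
      B∩A=∅ = subst Empty (∩-comm A B) A∩B=∅
      B∪A≡K∪L = trans (∪-comm B A) A∪B≡K∪L

  χ-≤ₘ-χ⇒≡ : ∀ {G I} → Irr G → Upper I → Nonempty I → χ I ≤ₘ χ G → G ≡ I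
  χ-≤ₘ-χ⇒≡ {G} {I} irG upI (x , x∈I) χI≤χG = ⊆-antisym G⊆I I⊆G
    where
    I⊆G = χ-≤ₘ⇒⊆ {I} {G} χI≤χG
    G⊆I = irreducible-⊆ irG upI (χ-≤ₘ⇒Upper-∩∁ (proj₁ irG) χI≤χG) (x , x∈p∩q⁺ (I⊆G x∈I , x∈I))

  NotBelow∪∩ : Subset n → Set
  NotBelow∪∩ I = ∀ G H → Irr G → Irr H → G ≢ I → H ≢ I →
                 ¬ (χ I ≤ₘ χ (G ∪ H)) × ¬ (χ I ≤ₘ χ (G ∩ H))

  NotBelow∪∩⇒∪≢ : ∀ {I G H} → NotBelow∪∩ I → Irr G → Irr H → G ≢ I → H ≢ I → G ∪ H ≢ I
  NotBelow∪∩⇒∪≢ {I} {G} {H} notBelow irG irH G≢I H≢I G∪H≡I =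
    proj₁ (notBelow G H irG irH G≢I H≢I) (subst (λ U → χ I ≤ₘ χ U) (sym G∪H≡I) ≤ₘ-refl)

  NearChainWithAll : Subset n → Set
  NearChainWithAll I = ∀ J → Irr J → J ≢ I → NearChain I J

  module _ {I} (irI : Irr I) (prime : IsPrime _≼_ (χ I)) where

    private
      upI = proj₁ irI
      neI = proj₁ (proj₂ irI)

    prime⇒χ≰χ+χ : ∀ {G H} → Irr G → Irr H → G ≢ I → H ≢ I → ¬ (χ I ≤ₘ (λ x → χ G x + χ H x))
    prime⇒χ≰χ+χ irG@(upG , _) irH@(upH , _) G≢I H≢I χI≤χG+χH
      with prime _ _ (χ-monotone upG) (χ-monotone upH) χI≤χG+χH
    ... | inj₁ χI≤χG = G≢I (χ-≤ₘ-χ⇒≡ irG upI neI χI≤χG)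
    ... | inj₂ χI≤χH = H≢I (χ-≤ₘ-χ⇒≡ irH upI neI χI≤χH)

    prime⇒NotBelow∪∩ : NotBelow∪∩ I
    prime⇒NotBelow∪∩ G H irG@(upG , _) irH@(upH , _) G≢I H≢I = below-∪ , below-∩
      where
      below-∪ : ¬ (χ I ≤ₘ χ (G ∪ H))
      below-∪ χI≤χG∪H = prime⇒χ≰χ+χ irG irH G≢I H≢I
        (≤ₘ-resp-≗ (χ-∪+χ-∩ G H) (≤ₘ-+ʳ χI≤χG∪H (χ-monotone (Upper-∩ upG upH))))
      below-∩ : ¬ (χ I ≤ₘ χ (G ∩ H))
      below-∩ χI≤χG∩H = prime⇒χ≰χ+χ irG irH G≢I H≢I
        (≤ₘ-resp-≗ (λ x → trans (+-comm (χ (G ∩ H) x) _) (χ-∪+χ-∩ G H x))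
                   (≤ₘ-+ʳ χI≤χG∩H (χ-monotone (Upper-∪ upG upH))))

    prime⇒⊆⊎⊇ : ∀ {J} → Irr J → Nonempty (I ∩ J) → I ⊆ J ⊎ J ⊆ I
    prime⇒⊆⊎⊇ {J} irJ@(upJ , _) (z , z∈I∩J)
      with prime (χ (I ∪ J)) (χ (I ∩ J))
                 (χ-monotone (Upper-∪ upI upJ)) (χ-monotone (Upper-∩ upI upJ))
                 (χ J , χ-monotone upJ , χ-∪+χ-∩ I J)
    ... | inj₁ χI≤χI∪J =
      inj₂ (irreducible-⊆-side irJ upI (χ-≤ₘ⇒Upper-∩∁ (Upper-∪ upI upJ) χI≤χI∪J)
              (∁-disjoint I (I ∪ J)) J⊆I∪[I∪J]∖I (z , x∈p∩q⁺ (p∩q⊆q I J z∈I∩J , p∩q⊆p I J z∈I∩J)))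
      where
      J⊆I∪[I∪J]∖I : J ⊆ I ∪ ((I ∪ J) ∩ ∁ I)
      J⊆I∪[I∪J]∖I x∈J = ⊆-∪∁ I (I ∪ J) (q⊆p∪q I J x∈J)
    ... | inj₂ χI≤χI∩J = inj₁ (λ x∈I → p∩q⊆q I J (χ-≤ₘ⇒⊆ {I} {I ∩ J} χI≤χI∩J x∈I))

    prime⇒NearChainWithAll : NearChainWithAll I
    prime⇒NearChainWithAll J irJ _ with nonempty? (I ∩ J)
    ... | no  I∩J=∅ = inj₂ (inj₂ I∩J=∅)
    ... | yes I∩J≠∅ with prime⇒⊆⊎⊇ irJ I∩J≠∅
    ...   | inj₁ I⊆J = inj₁ I⊆J
    ...   | inj₂ J⊆I = inj₂ (inj₁ J⊆I)

  module _ (po : IsDecPartialOrder _≡_ _≼_) where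

    open IsDecPartialOrder po using (antisym; _≟_)
      renaming (refl to ≼-refl; trans to ≼-trans; _≤?_ to _≼?_)

    infix 10 ↑_
    ↑_ : Fin n → Subset n
    ↑ m = tabulate λ y → does (m ≼? y)

    ≼⇒∈↑ : ∀ {m y} → m ≼ y → y ∈ ↑ m
    ≼⇒∈↑ {m} {y} m≼y =
      lookup⇒[]= y (↑ m) (trans (lookup∘tabulate (λ y → does (m ≼? y)) y) (dec-true (m ≼? y) m≼y))

    ∈↑⇒≼ : ∀ {m y} → y ∈ ↑ m → m ≼ y
    ∈↑⇒≼ {m} {y} y∈↑m = decidable-stable (m ≼? y) λ m⋠y → contradiction
      (trans (sym ([]=⇒lookup y∈↑m))
             (trans (lookup∘tabulate (λ y → does (m ≼? y)) y) (dec-false (m ≼? y) m⋠y)))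
      λ ()

    ↑-least : ∀ {A m} → Upper A → m ∈ A → ↑ m ⊆ A
    ↑-least upA m∈A y∈↑m = upA _ _ (∈↑⇒≼ y∈↑m) m∈A

    ↑-injective : ∀ {x y} → ↑ x ≡ ↑ y → x ≡ y
    ↑-injective {x} {y} ↑x≡↑y =
      antisym (∈↑⇒≼ (subst (y ∈_) (sym ↑x≡↑y) (≼⇒∈↑ ≼-refl)))
              (∈↑⇒≼ (subst (x ∈_) ↑x≡↑y (≼⇒∈↑ ≼-refl)))

    ↑-upper : ∀ {m} → Upper (↑ m)
    ↑-upper x y x≼y x∈↑m = ≼⇒∈↑ (≼-trans (∈↑⇒≼ x∈↑m) x≼y)

    ↑-irreducible : ∀ m → Irr (↑ m)
    ↑-irreducible m = ↑-upper , (m , ≼⇒∈↑ ≼-refl) , connected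
      where
      connected : Connected (↑ m)
      connected (A , B , upA , upB , (a , a∈A) , (b , b∈B) , A∩B=∅ , A∪B≡↑m)
        with x∈p∪q⁻ A B (subst (m ∈_) (sym A∪B≡↑m) (≼⇒∈↑ ≼-refl))
      ... | inj₁ m∈A = A∩B=∅ (b , x∈p∩q⁺ (↑-least upA m∈A (subst (B ⊆_) A∪B≡↑m (q⊆p∪q A B) b∈B) , b∈B))
      ... | inj₂ m∈B = A∩B=∅ (a , x∈p∩q⁺ (a∈A , ↑-least upB m∈B (subst (A ⊆_) A∪B≡↑m (p⊆p∪q B) a∈A)))

    infix 4 _≟ₛ_
    _≟ₛ_ : (A B : Subset n) → Dec (A ≡ B)
    _≟ₛ_ = ≡-dec Data.Bool._≟_

    irreducible-entry : ∀ {I K} → Irr I → Upper K → Nonempty K → K ⊆ I → K ≢ I →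
                        ∃ λ y → y ∈ I × y ∉ K × Nonempty (↑ y ∩ K)
    irreducible-entry {I} {K} irI@(upI , _) upK (k , k∈K) K⊆I K≢I
      with any? (λ y → y ∈? I ×-dec ¬? (y ∈? K) ×-dec nonempty? (↑ y ∩ K))
    ... | yes entry    = entry
    ... | no  no-entry = contradiction (⊆-antisym K⊆I I⊆K) K≢I
      where
      upI∖K : Upper (I ∩ ∁ K)
      upI∖K y z y≼z y∈I∖K = x∈p∩q⁺ (upI y z y≼z y∈I , x∉p⇒x∈∁p z∉K)
        where
        y∈I = p∩q⊆p I (∁ K) y∈I∖K
        z∉K : z ∉ K
        z∉K z∈K = no-entry (y , y∈I , x∈∁p⇒x∉p (p∩q⊆q I (∁ K) y∈I∖K) , z , x∈p∩q⁺ (≼⇒∈↑ y≼z , z∈K))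
      I⊆K = irreducible-⊆ irI upK upI∖K (k , x∈p∩q⁺ (K⊆I k∈K , k∈K))

    irreducible-principal : ∀ {I} → Irr I →
                            (∀ {G H} → Irr G → Irr H → G ≢ I → H ≢ I → G ∪ H ≢ I) →
                            ∃ λ m → ↑ m ≡ I
    irreducible-principal {I} irI@(upI , (m , m∈I) , _) no-cover with ↑ m ≟ₛ I
    ... | yes ↑m≡I = m , ↑m≡I
    ... | no  ↑m≢I = grow ∣ I ∣ (↑-irreducible m) (↑-least upI m∈I) ↑m≢I (m≤m+n ∣ I ∣ ∣ ↑ m ∣)
      where
      -- Each step adds some y ∉ K while no-cover keeps K ≢ I, so k bounds the remaining steps.
      grow : ∀ k {K} → Irr K → K ⊆ I → K ≢ I → ∣ I ∣ ≤ k + ∣ K ∣ → ∃ λ m → ↑ m ≡ I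
      grow k {K} irK@(upK , neK , _) K⊆I K≢I size with irreducible-entry irI upK neK K⊆I K≢I
      ... | y , y∈I , y∉K , ↑y∩K≠∅ with ↑ y ≟ₛ I | k
      ...   | yes ↑y≡I | _     = y , ↑y≡I
      ...   | no  _    | zero  = contradiction size (<⇒≱ (p⊂q⇒∣p∣<∣q∣ (K⊆I , y , y∈I , y∉K)))
      ...   | no  ↑y≢I | suc k =
        grow k (irreducible-∪ (↑-irreducible y) irK ↑y∩K≠∅) ↑y∪K⊆I
             (no-cover (↑-irreducible y) irK ↑y≢I K≢I) size′
        where
        ↑y∪K⊆I : ↑ y ∪ K ⊆ I
        ↑y∪K⊆I x∈↑y∪K with x∈p∪q⁻ (↑ y) K x∈↑y∪K
        ... | inj₁ x∈↑y = ↑-least upI y∈I x∈↑y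
        ... | inj₂ x∈K  = K⊆I x∈K
        K⊂↑y∪K : K ⊂ ↑ y ∪ K
        K⊂↑y∪K = q⊆p∪q (↑ y) K , y , p⊆p∪q K (≼⇒∈↑ ≼-refl) , y∉K
        size′ : ∣ I ∣ ≤ k + ∣ ↑ y ∪ K ∣
        size′ = begin
          ∣ I ∣            ≤⟨ size ⟩
          suc k + ∣ K ∣     ≡⟨ +-suc k ∣ K ∣ ⟨
          k + suc ∣ K ∣     ≤⟨ +-monoʳ-≤ k (p⊂q⇒∣p∣<∣q∣ K⊂↑y∪K) ⟩
          k + ∣ ↑ y ∪ K ∣   ∎
          where open ≤-Reasoning

    ⋠⇒∉↑ : ∀ {m y} → ¬ m ≼ y → y ∉ ↑ m
    ⋠⇒∉↑ m⋠y y∈↑m = m⋠y (∈↑⇒≼ y∈↑m)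

    infix 4 _≺_ _≺?_
    _≺_ : Fin n → Fin n → Set
    x ≺ y = x ≼ y × x ≢ y

    _≺?_ : ∀ x y → Dec (x ≺ y)
    x ≺? y = x ≼? y ×-dec ¬? (x ≟ y)

    IsGateway : Fin n → Set
    IsGateway m = ∀ {x y} → ¬ m ≼ x → x ≼ y → m ≼ y → x ≼ m

    JumpsAt : Fin n → (Fin n → ℕ) → Set
    JumpsAt m f = 1 ≤ f m × (∀ x → x ≺ m → f x < f m)

    jumpsAt? : ∀ m f → Dec (JumpsAt m f)
    jumpsAt? m f = 1 ≤? f m ×-dec all? (λ x → x ≺? m →-dec f x <? f m)

    χ↑-≤ₘ⇒JumpsAt : ∀ {m f} → χ (↑ m) ≤ₘ f → JumpsAt m f
    χ↑-≤ₘ⇒JumpsAt {m} {f} χ↑m≤f = subst (_≤ f m) (χ-∈ m∈↑m) (≤ₘ⇒≤ χ↑m≤f m) , jump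
      where
      m∈↑m = ≼⇒∈↑ ≼-refl
      jump : ∀ x → x ≺ m → f x < f m
      jump x (x≼m , x≢m) = subst₂ _≤_ eq₁ eq₂ (≤ₘ-gap-monotone χ↑m≤f x≼m)
        where
        eq₁ : f x + χ (↑ m) m ≡ suc (f x)
        eq₁ = trans (cong (f x +_) (χ-∈ m∈↑m)) (+-comm (f x) 1)
        eq₂ : χ (↑ m) x + f m ≡ f m
        eq₂ = cong (_+ f m) (χ-∉ (⋠⇒∉↑ λ m≼x → x≢m (antisym x≼m m≼x)))

    JumpsAt⇒χ↑-≤ₘ : ∀ {m f} → IsGateway m → Mono f → JumpsAt m f → χ (↑ m) ≤ₘ f
    JumpsAt⇒χ↑-≤ₘ {m} {f} gateway f-mono (1≤fm , jump) =
      (λ x → f x ∸ χ (↑ m) x) , h-mono , λ x → sym (m+[n∸m]≡n (χ≤f x))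
      where
      χ≤f : ∀ x → χ (↑ m) x ≤ f x
      χ≤f x with m ≼? x
      ... | yes m≼x rewrite χ-∈ (≼⇒∈↑ m≼x) = ≤-trans 1≤fm (f-mono m x m≼x)
      ... | no  m⋠x rewrite χ-∉ (⋠⇒∉↑ m⋠x) = z≤n
      h-mono : Mono (λ x → f x ∸ χ (↑ m) x)
      h-mono x y x≼y with m ≼? x | m ≼? y
      ... | yes m≼x | yes m≼y rewrite χ-∈ (≼⇒∈↑ m≼x) | χ-∈ (≼⇒∈↑ m≼y) = ∸-monoˡ-≤ 1 (f-mono x y x≼y)
      ... | yes m≼x | no  m⋠y = contradiction (≼-trans m≼x x≼y) m⋠y
      ... | no  m⋠x | yes m≼y rewrite χ-∉ (⋠⇒∉↑ m⋠x) | χ-∈ (≼⇒∈↑ m≼y) =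
        ∸-monoˡ-≤ 1 (<-≤-trans (jump x x≺m) (f-mono m y m≼y))
        where
        x≺m : x ≺ m
        x≺m = gateway m⋠x x≼y m≼y , λ { refl → m⋠x ≼-refl }
      ... | no  m⋠x | no  m⋠y rewrite χ-∉ (⋠⇒∉↑ m⋠x) | χ-∉ (⋠⇒∉↑ m⋠y) = f-mono x y x≼y

    ¬JumpsAt⇒ : ∀ {m f} → ¬ JumpsAt m f → f m ≡ 0 ⊎ ∃ λ x → x ≺ m × f m ≤ f x
    ¬JumpsAt⇒ {m} {f} ¬jump with 1 ≤? f m
    ... | no  1≰fm = inj₁ (n<1⇒n≡0 (≰⇒> 1≰fm))
    ... | yes 1≤fm with any? (λ x → x ≺? m ×-dec ¬? (f x <? f m))
    ...   | yes (x , x≺m , fx≮fm) = inj₂ (x , x≺m , ≮⇒≥ fx≮fm)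
    ...   | no  none = contradiction (1≤fm , jump) ¬jump
      where
      jump : ∀ x → x ≺ m → f x < f m
      jump x x≺m = decidable-stable (f x <? f m) λ fx≮fm → none (x , x≺m , fx≮fm)

    ¬JumpsAt²⇒ : ∀ {m b c} → ¬ JumpsAt m b → ¬ JumpsAt m c → 1 ≤ b m + c m →
                 ∃₂ λ x x′ → x ≺ m × x′ ≺ m × b m ≤ b x × c m ≤ c x′
    ¬JumpsAt²⇒ {m} {b} {c} ¬jb ¬jc 1≤bm+cm with ¬JumpsAt⇒ ¬jb | ¬JumpsAt⇒ ¬jc
    ... | inj₁ bm≡0 | inj₁ cm≡0 = contradiction (subst (1 ≤_) (cong₂ _+_ bm≡0 cm≡0) 1≤bm+cm) λ ()
    ... | inj₁ bm≡0 | inj₂ (x′ , x′≺m , cm≤cx′) =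
      x′ , x′ , x′≺m , x′≺m , subst (_≤ b x′) (sym bm≡0) z≤n , cm≤cx′
    ... | inj₂ (x , x≺m , bm≤bx) | inj₁ cm≡0 =
      x , x , x≺m , x≺m , bm≤bx , subst (_≤ c x) (sym cm≡0) z≤n
    ... | inj₂ (x , x≺m , bm≤bx) | inj₂ (x′ , x′≺m , cm≤cx′) =
      x , x′ , x≺m , x′≺m , bm≤bx , cm≤cx′

    JumpsAt-χ↑∩↑ : ∀ {m b c x x′} → Mono b → Mono c → JumpsAt m (λ z → b z + c z) →
                   x ≺ m → x′ ≺ m → b m ≤ b x → c m ≤ c x′ → JumpsAt m (χ (↑ x ∩ ↑ x′))
    JumpsAt-χ↑∩↑ {m} {b} {c} {x} {x′} b-mono c-mono (_ , b+c-jump) (x≼m , _) (x′≼m , _) bm≤bx cm≤cx′ =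
      subst (1 ≤_) (sym (χ-∈ m∈↑x∩↑x′)) ≤-refl , jump
      where
      m∈↑x∩↑x′ = x∈p∩q⁺ (≼⇒∈↑ x≼m , ≼⇒∈↑ x′≼m)
      jump : ∀ z → z ≺ m → χ (↑ x ∩ ↑ x′) z < χ (↑ x ∩ ↑ x′) m
      jump z z≺m with z ∈? ↑ x ∩ ↑ x′
      ... | no  z∉↑x∩↑x′ = subst₂ _<_ (sym (χ-∉ z∉↑x∩↑x′)) (sym (χ-∈ m∈↑x∩↑x′)) ≤-refl
      ... | yes z∈↑x∩↑x′ = contradiction (+-mono-≤ bm≤bz cm≤cz) (<⇒≱ (b+c-jump z z≺m))
        where
        bm≤bz = ≤-trans bm≤bx (b-mono x z (∈↑⇒≼ (p∩q⊆p (↑ x) (↑ x′) z∈↑x∩↑x′)))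
        cm≤cz = ≤-trans cm≤cx′ (c-mono x′ z (∈↑⇒≼ (p∩q⊆q (↑ x) (↑ x′) z∈↑x∩↑x′)))

    ↑-prime : ∀ {m} → IsGateway m → (∀ {x x′} → x ≺ m → x′ ≺ m → ¬ (χ (↑ m) ≤ₘ χ (↑ x ∩ ↑ x′))) →
              IsPrime _≼_ (χ (↑ m))
    ↑-prime {m} gateway separated b c b-mono c-mono χ↑m≤b+c
      with χ↑-≤ₘ⇒JumpsAt χ↑m≤b+c | jumpsAt? m b | jumpsAt? m c
    ... | _         | yes jb | _      = inj₁ (JumpsAt⇒χ↑-≤ₘ gateway b-mono jb)
    ... | _         | no  _  | yes jc = inj₂ (JumpsAt⇒χ↑-≤ₘ gateway c-mono jc)
    ... | b+c-jumps | no ¬jb | no ¬jc with ¬JumpsAt²⇒ ¬jb ¬jc (proj₁ b+c-jumps)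
    ...   | x , x′ , x≺m , x′≺m , bm≤bx , cm≤cx′ = contradiction
      (JumpsAt⇒χ↑-≤ₘ gateway (χ-monotone (Upper-∩ ↑-upper ↑-upper))
        (JumpsAt-χ↑∩↑ b-mono c-mono b+c-jumps x≺m x′≺m bm≤bx cm≤cx′))
      (separated x≺m x′≺m)

    NearChain⇒IsGateway : ∀ {m} → (∀ {x} → ¬ m ≼ x → NearChain (↑ m) (↑ x)) → IsGateway m
    NearChain⇒IsGateway {m} nearChain {x} {y} m⋠x x≼y m≼y with nearChain m⋠x
    ... | inj₁ ↑m⊆↑x          = ∈↑⇒≼ (↑m⊆↑x (≼⇒∈↑ ≼-refl))
    ... | inj₂ (inj₁ ↑x⊆↑m)   = contradiction (↑x⊆↑m (≼⇒∈↑ ≼-refl)) (⋠⇒∉↑ m⋠x)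
    ... | inj₂ (inj₂ ↑m∩↑x=∅) = contradiction (y , x∈p∩q⁺ (≼⇒∈↑ m≼y , ≼⇒∈↑ x≼y)) ↑m∩↑x=∅

    conditions⇒prime : ∀ {I} → Irr I → NotBelow∪∩ I → NearChainWithAll I → IsPrime _≼_ (χ I)
    conditions⇒prime irI notBelow nearChain with irreducible-principal irI (NotBelow∪∩⇒∪≢ notBelow)
    ... | m , refl = ↑-prime gateway separated
      where
      ↑≢↑m : ∀ {x} → x ≢ m → ↑ x ≢ ↑ m
      ↑≢↑m x≢m = x≢m ∘ ↑-injective
      gateway : IsGateway m
      gateway = NearChain⇒IsGateway λ {x} m⋠x →
        nearChain (↑ x) (↑-irreducible x) (↑≢↑m λ { refl → m⋠x ≼-refl })
      separated : ∀ {x x′} → x ≺ m → x′ ≺ m → ¬ (χ (↑ m) ≤ₘ χ (↑ x ∩ ↑ x′))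
      separated (_ , x≢m) (_ , x′≢m) =
        proj₂ (notBelow _ _ (↑-irreducible _) (↑-irreducible _) (↑≢↑m x≢m) (↑≢↑m x′≢m))

theorem13 : (n : ℕ) (_≼_ : Fin n → Fin n → Set) → IsDecPartialOrder _≡_ _≼_ →
    (I : Subset n) → Irreducible _≼_ I →
    IsPrime _≼_ (χ I) ⇔
      ((∀ G H → Irreducible _≼_ G → Irreducible _≼_ H → G ≢ I → H ≢ I →
          ¬ (_≤M_ _≼_ (χ I) (χ (G ∪ H))) × ¬ (_≤M_ _≼_ (χ I) (χ (G ∩ H))))
       × (∀ J → Irreducible _≼_ J → J ≢ I → NearChain I J))
theorem13 n _≼_ po I irI = mk⇔
  (λ prime → prime⇒NotBelow∪∩ _≼_ irI prime , prime⇒NearChainWithAll _≼_ irI prime)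
  (λ (notBelow , nearChain) → conditions⇒prime _≼_ po irI notBelow nearChain)
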